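{- For every $r\ge1$, the interval $[0,F_{3r})$ contains equally many $n$ with $\mathrm{ftm}(n)=0$ and with $\mathrm{ftm}(n)=1$, and \[ \sum_{\substack{n<F_{3r}\\ \mathrm{ftm}(n)=0}}n-\sum_{\substack{n<F_{3r}\\ \mathrm{ftm}(n)=1}}n=(-1)^r\,\frac{F_{3r+1}-1}{2}. \]
   Context: $F_k$ denotes the Fibonacci numbers with $F_1=F_2=1$, $F_{k+1}=F_k+F_{k-1}$. $s_F(n)$ is the digit sum of the Zeckendorf representation of $n$ (its unique representation as a sum of non-consecutive Fibonacci numbers $F_k$, $k\ge2$), and $\mathrm{ftm}(n)=s_F(n)\bmod 2$ is the Fibonacci--Thue--Morse sequence. -}

module Defs where

open import Data.Nat using (ℕ; zero; suc; _+_; _∸_; _≤?_; _%_; _≟_; _≤ᵇ_)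
open import Data.List using (List; []; _∷_; sum; map; filter; length; upTo)
open import Data.Bool using (Bool; true; false; if_then_else_)
open import Relation.Nullary using (yes; no)
open import Data.Integer as ℤ using (ℤ; +_; -_)

F : ℕ → ℕ
F 0 = 0
F 1 = 1
F (suc (suc k)) = F (suc k) + F k

-- Largest Fibonacci number F_k (k ≥ 2) that is ≤ n, for n ≥ 1; searched
-- among F 2 .. F (n+2) (enough since F (n+2) > n).
lfbGo : ℕ → ℕ → ℕ
lfbGo n 0 = 0
lfbGo n 1 = 0
lfbGo n (suc (suc k)) = if F (suc (suc k)) ≤ᵇ n then F (suc (suc k)) else lfbGo n (suc k)

largestFibBelow : ℕ → ℕ
largestFibBelow n = lfbGo n (suc (suc n))

-- Zeckendorf digit sum via the greedy algorithm (which produces the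
-- Zeckendorf representation): number of summands. Fuel argument ≥ n.
sFfuel : ℕ → ℕ → ℕ
sFfuel zero    n = 0
sFfuel (suc f) zero = 0
sFfuel (suc f) n@(suc _) = suc (sFfuel f (n ∸ largestFibBelow n))

sF : ℕ → ℕ
sF n = sFfuel n n

ftm : ℕ → ℕ
ftm n = sF n % 2

ftmClass : ℕ → ℕ → List ℕ
ftmClass b N = filter (λ n → ftm n ≟ b) (upTo N)

-- Split [0, F (k+3)) into [0, F (k+2)) and the translate F (k+2) + [0, F (k+1)). On the second
-- block the greedy algorithm first takes F (k+2), so there s_F goes up by one and ftm is flipped.
-- Hence the differences Δ_k (of counts) and Σ_k (of sums) between the classes ftm = 0 and ftm = 1
-- below F_k satisfy  Δ_{k+3} = Δ_{k+2} − Δ_{k+1}  and  Σ_{k+3} = Σ_{k+2} − F_{k+2} Δ_{k+1} − Σ_{k+1}.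
-- Shifting k by 3 negates the solution of these recurrences, which gives the closed forms at k = 3r
-- by induction on r.
module Submission where

open import Defs

module FibonacciBlocks where

  open import Data.Nat
    using (ℕ; zero; suc; _+_; _*_; _∸_; _≤_; _<_; z≤n; s≤s; _≤ᵇ_; _%_; _≟_)
  open import Data.Nat.Properties
  open import Data.Nat.DivMod using (_/_; m%n<n; m*n/n≡m)
  open import Data.Nat.ListAction using (sum)
  open import Data.Nat.ListAction.Properties using (sum-++)
  open import Data.Nat.Tactic.RingSolver using (solve-∀)
  open import Data.Bool using (true; false; T)
  open import Data.Empty using (⊥-elim)
  open import Data.Sum using (inj₁; inj₂)
  open import Data.Product using (∃; _,_)
  open import Data.List using (List; []; _∷_; _++_; map; filter; length; upTo; applyUpTo)
  open import Data.List.Properties using (map-upTo; filter-++; length-++; length-map)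
  open import Data.List.Relation.Unary.All using (All; []; _∷_)
  open import Data.List.Relation.Unary.All.Properties using (applyUpTo⁺₁)
  open import Relation.Nullary using (does)
  open import Relation.Unary using (Pred; Decidable)
  open import Relation.Binary.PropositionalEquality
  open ≡-Reasoning

  F-positive : ∀ k → 1 ≤ F (suc k)
  F-positive zero    = s≤s z≤n
  F-positive (suc k) = ≤-trans (F-positive k) (m≤m+n (F (suc k)) (F k))

  F-≤-suc : ∀ k → F k ≤ F (suc k)
  F-≤-suc zero    = z≤n
  F-≤-suc (suc k) = m≤m+n (F (suc k)) (F k)

  F-mono-≤ : ∀ {i j} → i ≤ j → F i ≤ F j
  F-mono-≤ i≤j with m≤n⇒m<n∨m≡n i≤j
  ... | inj₂ refl               = ≤-refl
  ... | inj₁ (s≤s {n = j} i≤j) = ≤-trans (F-mono-≤ i≤j) (F-≤-suc j)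

  k<F[2+k] : ∀ k → k < F (suc (suc k))
  k<F[2+k] zero    = s≤s z≤n
  k<F[2+k] (suc k) = subst (_≤ F (3 + k)) (+-comm (suc k) 1) (+-mono-≤ (k<F[2+k] k) (F-positive k))

  F-odd-step : ∀ n q → F (suc n) ≡ suc (q * 2) → F (4 + n) ≡ suc ((q + F (2 + n)) * 2)
  F-odd-step n q odd = trans (cong (λ t → F (2 + n) + t + F (2 + n)) odd) (lemma q (F (2 + n)))
    where
    lemma : ∀ q x → x + suc (q * 2) + x ≡ suc ((q + x) * 2)
    lemma = solve-∀

  F-odd-at-3r+1 : ∀ r → ∃ λ q → F (suc (3 * r)) ≡ suc (q * 2)
  F-odd-at-3r+1 zero = 0 , refl
  F-odd-at-3r+1 (suc r) with F-odd-at-3r+1 r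
  ... | q , odd = q + F (2 + 3 * r) ,
    subst (λ m → F (suc m) ≡ suc ((q + F (2 + 3 * r)) * 2)) (sym (*-suc 3 r)) (F-odd-step (3 * r) q odd)

  ∸1/2-odd : ∀ {m} q → m ≡ suc (q * 2) → (m ∸ 1) / 2 ≡ q
  ∸1/2-odd q refl = m*n/n≡m q 2

  lfbGo-positive : ∀ {n} k → 1 ≤ n → 1 ≤ lfbGo n (suc (suc k))
  lfbGo-positive {n} zero 1≤n with 1 ≤ᵇ n in eq
  ... | true  = s≤s z≤n
  ... | false = ⊥-elim (subst T eq (≤⇒≤ᵇ 1≤n))
  lfbGo-positive {n} (suc k) 1≤n with F (3 + k) ≤ᵇ n
  ... | true  = F-positive (2 + k)
  ... | false = lfbGo-positive k 1≤n

  lfbGo-between : ∀ {n k} j → F (2 + k) ≤ n → n < F (3 + k) → k ≤ j →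
                  lfbGo n (suc (suc j)) ≡ F (2 + k)
  lfbGo-between {n} {k} j lo hi k≤j with F (2 + j) ≤ᵇ n in eq | m≤n⇒m<n∨m≡n k≤j
  ... | true  | inj₂ refl = refl
  ... | true  | inj₁ k<j  =
    ⊥-elim (<⇒≱ hi (≤-trans (F-mono-≤ (s≤s (s≤s k<j))) (≤ᵇ⇒≤ (F (2 + j)) n (subst T (sym eq) _))))
  ... | false | inj₂ refl = ⊥-elim (subst T eq (≤⇒≤ᵇ lo))
  lfbGo-between (suc j) lo hi _ | false | inj₁ (s≤s k≤j) = lfbGo-between j lo hi k≤j

  largestFibBelow-between : ∀ {n} k → F (2 + k) ≤ n → n < F (3 + k) → largestFibBelow n ≡ F (2 + k)
  largestFibBelow-between {n} k lo hi =
    lfbGo-between n lo hi (≤-trans (n≤1+n k) (≤-trans (k<F[2+k] k) lo))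

  sFfuel-irrelevant : ∀ {f g} n → n ≤ f → n ≤ g → sFfuel f n ≡ sFfuel g n
  sFfuel-irrelevant {zero}  {zero}  zero _ _ = refl
  sFfuel-irrelevant {zero}  {suc g} zero _ _ = refl
  sFfuel-irrelevant {suc f} {zero}  zero _ _ = refl
  sFfuel-irrelevant {suc f} {suc g} zero _ _ = refl
  sFfuel-irrelevant {suc f} {suc g} (suc n) (s≤s n≤f) (s≤s n≤g) =
    cong suc (sFfuel-irrelevant _ (≤-trans remainder≤n n≤f) (≤-trans remainder≤n n≤g))
    where
    remainder≤n : suc n ∸ largestFibBelow (suc n) ≤ n
    remainder≤n with largestFibBelow (suc n) | lfbGo-positive {suc n} (suc n) (s≤s z≤n)
    ... | suc L | _ = m∸n≤m n L

  sF-after-greedy-step : ∀ {a} m → 1 ≤ a → largestFibBelow (a + m) ≡ a → sF (a + m) ≡ suc (sF m)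
  sF-after-greedy-step {suc p} m _ greedy = cong suc (begin
    sFfuel (p + m) (suc p + m ∸ largestFibBelow (suc p + m))
      ≡⟨ cong (λ L → sFfuel (p + m) (suc p + m ∸ L)) greedy ⟩
    sFfuel (p + m) (suc p + m ∸ suc p)
      ≡⟨ cong (sFfuel (p + m)) (m+n∸m≡n (suc p) m) ⟩
    sFfuel (p + m) m
      ≡⟨ sFfuel-irrelevant m (m≤n+m m p) ≤-refl ⟩
    sF m
      ∎)

  sF-shift : ∀ k {m} → m < F (suc k) → sF (F (2 + k) + m) ≡ suc (sF m)
  sF-shift k {m} m<F = sF-after-greedy-step m (F-positive (suc k))
    (largestFibBelow-between k (m≤m+n _ m) (+-monoʳ-< (F (2 + k)) m<F))

  suc-%2 : ∀ x → suc x % 2 ≡ 1 ∸ x % 2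
  suc-%2 zero          = refl
  suc-%2 (suc zero)    = refl
  suc-%2 (suc (suc x)) = suc-%2 x

  ftm≤1 : ∀ n → ftm n ≤ 1
  ftm≤1 n = ≤-pred (m%n<n (sF n) 2)

  ftm-shift : ∀ k {m} → m < F (suc k) → ftm (F (2 + k) + m) ≡ 1 ∸ ftm m
  ftm-shift k {m} m<F = trans (cong (_% 2) (sF-shift k m<F)) (suc-%2 (sF m))

  1∸-≟ : ∀ {x b} → x ≤ 1 → b ≤ 1 → does (1 ∸ x ≟ b) ≡ does (x ≟ 1 ∸ b)
  1∸-≟ z≤n       z≤n       = refl
  1∸-≟ z≤n       (s≤s z≤n) = refl
  1∸-≟ (s≤s z≤n) z≤n       = refl
  1∸-≟ (s≤s z≤n) (s≤s z≤n) = refl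

  applyUpTo-+ : ∀ {A : Set} (f : ℕ → A) a n →
                applyUpTo f (a + n) ≡ applyUpTo f a ++ applyUpTo (λ i → f (a + i)) n
  applyUpTo-+ f zero    n = refl
  applyUpTo-+ f (suc a) n = cong (f 0 ∷_) (applyUpTo-+ (λ i → f (suc i)) a n)

  upTo-+ : ∀ a n → upTo (a + n) ≡ upTo a ++ map (a +_) (upTo n)
  upTo-+ a n = trans (applyUpTo-+ (λ i → i) a n) (cong (upTo a ++_) (sym (map-upTo (a +_) n)))

  filter-map : ∀ {A B : Set} {ℓ} {P : Pred B ℓ} {Q : Pred A ℓ} (P? : Decidable P) (Q? : Decidable Q)
               (f : A → B) (xs : List A) → All (λ x → does (P? (f x)) ≡ does (Q? x)) xs →
               filter P? (map f xs) ≡ map f (filter Q? xs)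
  filter-map P? Q? f []       []       = refl
  filter-map P? Q? f (x ∷ xs) (agree ∷ agrees) with does (P? (f x)) | does (Q? x)
  ... | true  | true  = cong (f x ∷_) (filter-map P? Q? f xs agrees)
  ... | false | false = filter-map P? Q? f xs agrees
  filter-map P? Q? f (x ∷ xs) (() ∷ _) | true  | false
  filter-map P? Q? f (x ∷ xs) (() ∷ _) | false | true

  sum-map-+ : ∀ a xs → sum (map (a +_) xs) ≡ length xs * a + sum xs
  sum-map-+ a []       = refl
  sum-map-+ a (x ∷ xs) = trans (cong (a + x +_) (sum-map-+ a xs)) (lemma a x (length xs) (sum xs))
    where
    lemma : ∀ a x l s → a + x + (l * a + s) ≡ a + l * a + (x + s)
    lemma = solve-∀

  ftmClass-split : ∀ k {b} → b ≤ 1 →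
    ftmClass b (F (3 + k)) ≡ ftmClass b (F (2 + k)) ++ map (F (2 + k) +_) (ftmClass (1 ∸ b) (F (suc k)))
  ftmClass-split k {b} b≤1 = begin
    filter (λ n → ftm n ≟ b) (upTo (F (2 + k) + F (suc k)))
      ≡⟨ cong (filter (λ n → ftm n ≟ b)) (upTo-+ (F (2 + k)) (F (suc k))) ⟩
    filter (λ n → ftm n ≟ b) (upTo (F (2 + k)) ++ map (F (2 + k) +_) (upTo (F (suc k))))
      ≡⟨ filter-++ (λ n → ftm n ≟ b) (upTo (F (2 + k))) _ ⟩
    ftmClass b (F (2 + k)) ++ filter (λ n → ftm n ≟ b) (map (F (2 + k) +_) (upTo (F (suc k))))
      ≡⟨ cong (ftmClass b (F (2 + k)) ++_) (filter-map _ _ _ _ (applyUpTo⁺₁ _ (F (suc k)) flipped)) ⟩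
    ftmClass b (F (2 + k)) ++ map (F (2 + k) +_) (ftmClass (1 ∸ b) (F (suc k)))
      ∎
    where
    flipped : ∀ {m} → m < F (suc k) → does (ftm (F (2 + k) + m) ≟ b) ≡ does (ftm m ≟ 1 ∸ b)
    flipped {m} m<F = trans (cong (λ t → does (t ≟ b)) (ftm-shift k m<F)) (1∸-≟ (ftm≤1 m) b≤1)

  count : ℕ → ℕ → ℕ
  count b k = length (ftmClass b (F k))

  total : ℕ → ℕ → ℕ
  total b k = sum (ftmClass b (F k))

  count-rec : ∀ k {b} → b ≤ 1 → count b (3 + k) ≡ count b (2 + k) + count (1 ∸ b) (suc k)
  count-rec k {b} b≤1 rewrite ftmClass-split k b≤1 =
    trans (length-++ (ftmClass b (F (2 + k))))
          (cong (count b (2 + k) +_) (length-map _ (ftmClass (1 ∸ b) (F (suc k)))))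

  total-rec : ∀ k {b} → b ≤ 1 →
    total b (3 + k) ≡ total b (2 + k) + (count (1 ∸ b) (suc k) * F (2 + k) + total (1 ∸ b) (suc k))
  total-rec k {b} b≤1 rewrite ftmClass-split k b≤1 =
    trans (sum-++ (ftmClass b (F (2 + k))) _)
          (cong (total b (2 + k) +_) (sum-map-+ (F (2 + k)) (ftmClass (1 ∸ b) (F (suc k)))))

module SignedDifferences where

  open FibonacciBlocks using (count; total; count-rec; total-rec; ∸1/2-odd)
  open import Data.Nat as ℕ using (ℕ; zero; suc; z≤n; s≤s)
  open import Data.Nat.Properties using (*-suc)
  open import Data.Integer using (ℤ; +_; _+_; _-_; -_; _*_; _^_; 0ℤ; 1ℤ; -1ℤ)
  open import Data.Integer.Properties
    using (pos-*; +-inverseʳ; +-identityˡ; +-identityʳ; *-cancelˡ-≡; -1*i≡-i)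
  open import Data.Integer.Tactic.RingSolver using (solve-∀)
  open import Relation.Binary.PropositionalEquality

  fibℤ : ℕ → ℤ
  fibℤ k = + F k

  countDiff : ℕ → ℤ
  countDiff k = + count 0 k - + count 1 k

  sumDiff : ℕ → ℤ
  sumDiff k = + total 0 k - + total 1 k

  countDiff-rec : ∀ k → countDiff (3 ℕ.+ k) ≡ countDiff (2 ℕ.+ k) - countDiff (suc k)
  countDiff-rec k =
    trans (cong₂ (λ p q → + p - + q) (count-rec k z≤n) (count-rec k (s≤s z≤n)))
          (lemma (+ count 0 (2 ℕ.+ k)) (+ count 1 (suc k)) (+ count 1 (2 ℕ.+ k)) (+ count 0 (suc k)))
    where
    lemma : ∀ a b c x → (a + b) - (c + x) ≡ (a - c) - (x - b)
    lemma = solve-∀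

  sumDiff-rec : ∀ k →
    sumDiff (3 ℕ.+ k) ≡ sumDiff (2 ℕ.+ k) - fibℤ (2 ℕ.+ k) * countDiff (suc k) - sumDiff (suc k)
  sumDiff-rec k = begin
    + total 0 (3 ℕ.+ k) - + total 1 (3 ℕ.+ k)
      ≡⟨ cong₂ (λ p q → + p - + q) (total-rec k z≤n) (total-rec k (s≤s z≤n)) ⟩
    (t₀ + (+ (c₁ ℕ.* F (2 ℕ.+ k)) + s₁)) - (t₁ + (+ (c₀ ℕ.* F (2 ℕ.+ k)) + s₀))
      ≡⟨ cong₂ (λ u v → (t₀ + (u + s₁)) - (t₁ + (v + s₀)))
               (pos-* c₁ (F (2 ℕ.+ k))) (pos-* c₀ (F (2 ℕ.+ k))) ⟩
    (t₀ + (+ c₁ * fibℤ (2 ℕ.+ k) + s₁)) - (t₁ + (+ c₀ * fibℤ (2 ℕ.+ k) + s₀))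
      ≡⟨ lemma t₀ t₁ (+ c₀) (+ c₁) s₀ s₁ (fibℤ (2 ℕ.+ k)) ⟩
    sumDiff (2 ℕ.+ k) - fibℤ (2 ℕ.+ k) * countDiff (suc k) - sumDiff (suc k)
      ∎
    where
    open ≡-Reasoning
    t₀ t₁ s₀ s₁ : ℤ
    t₀ = + total 0 (2 ℕ.+ k)
    t₁ = + total 1 (2 ℕ.+ k)
    s₀ = + total 0 (suc k)
    s₁ = + total 1 (suc k)
    c₀ c₁ : ℕ
    c₀ = count 0 (suc k)
    c₁ = count 1 (suc k)
    lemma : ∀ t₀ t₁ c₀ c₁ s₀ s₁ x →
            (t₀ + (c₁ * x + s₁)) - (t₁ + (c₀ * x + s₀)) ≡ (t₀ - t₁) - x * (c₀ - c₁) - (s₀ - s₁)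
    lemma = solve-∀

  countDiff-step : ∀ k {a b} → countDiff (2 ℕ.+ k) ≡ a → countDiff (suc k) ≡ b →
                   countDiff (3 ℕ.+ k) ≡ a - b
  countDiff-step k refl refl = countDiff-rec k

  twice-sumDiff-step : ∀ k {a b c} →
    + 2 * sumDiff (2 ℕ.+ k) ≡ a → countDiff (suc k) ≡ b → + 2 * sumDiff (suc k) ≡ c →
    + 2 * sumDiff (3 ℕ.+ k) ≡ a - + 2 * fibℤ (2 ℕ.+ k) * b - c
  twice-sumDiff-step k refl refl refl =
    trans (cong (+ 2 *_) (sumDiff-rec k))
          (lemma (sumDiff (2 ℕ.+ k)) (fibℤ (2 ℕ.+ k)) (countDiff (suc k)) (sumDiff (suc k)))
    where
    lemma : ∀ a x b c → + 2 * (a - x * b - c) ≡ + 2 * a - + 2 * x * b - + 2 * c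
    lemma = solve-∀

  record ClosedFormsAt (n : ℕ) (s : ℤ) : Set where
    field
      count₀ : countDiff n ≡ 0ℤ
      count₁ : countDiff (suc n) ≡ s
      count₂ : countDiff (2 ℕ.+ n) ≡ s
      sum₀   : + 2 * sumDiff n ≡ s * (fibℤ (suc n) - 1ℤ)
      sum₁   : + 2 * sumDiff (suc n) ≡ s * (fibℤ (3 ℕ.+ n) - + 2)
      sum₂   : + 2 * sumDiff (2 ℕ.+ n) ≡ s * (fibℤ (2 ℕ.+ n) - 1ℤ)

  closedFormsAt-0 : ClosedFormsAt 0 1ℤ
  closedFormsAt-0 = record
    { count₀ = refl ; count₁ = refl ; count₂ = refl ; sum₀ = refl ; sum₁ = refl ; sum₂ = refl }

  -- fibℤ (k + 2) is definitionally fibℤ (k + 1) + fibℤ k, so after the recurrences each new closed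
  -- form is a polynomial identity in s, f₂ and f₃ alone.
  closedFormsAt-+3 : ∀ {n s} → ClosedFormsAt n s → ClosedFormsAt (3 ℕ.+ n) (- s)
  closedFormsAt-+3 {n} {s} cf = record
    { count₀ = count₃ ; count₁ = count₄ ; count₂ = count₅ ; sum₀ = sum₃ ; sum₁ = sum₄ ; sum₂ = sum₅ }
    where
    open ClosedFormsAt cf
    f₂ f₃ : ℤ
    f₂ = fibℤ (2 ℕ.+ n)
    f₃ = fibℤ (3 ℕ.+ n)
    identity₃ : ∀ s f₂ f₃ → s * (f₂ - 1ℤ) - + 2 * f₂ * s - s * (f₃ - + 2) ≡ - s * ((f₃ + f₂) - 1ℤ)
    identity₃ = solve-∀
    identity₄ : ∀ s f₂ f₃ → - s * ((f₃ + f₂) - 1ℤ) - + 2 * f₃ * s - s * (f₂ - 1ℤ)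
                          ≡ - s * ((((f₃ + f₂) + f₃) + (f₃ + f₂)) - + 2)
    identity₄ = solve-∀
    identity₅ : ∀ s f₂ f₃ →
      - s * ((((f₃ + f₂) + f₃) + (f₃ + f₂)) - + 2) - + 2 * (f₃ + f₂) * 0ℤ - - s * ((f₃ + f₂) - 1ℤ)
        ≡ - s * (((f₃ + f₂) + f₃) - 1ℤ)
    identity₅ = solve-∀
    count₃ : countDiff (3 ℕ.+ n) ≡ 0ℤ
    count₃ = trans (countDiff-step n count₂ count₁) (+-inverseʳ s)
    count₄ : countDiff (4 ℕ.+ n) ≡ - s
    count₄ = trans (countDiff-step (suc n) count₃ count₂) (+-identityˡ (- s))
    count₅ : countDiff (5 ℕ.+ n) ≡ - s
    count₅ = trans (countDiff-step (2 ℕ.+ n) count₄ count₃) (+-identityʳ (- s))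
    sum₃ : + 2 * sumDiff (3 ℕ.+ n) ≡ - s * (fibℤ (4 ℕ.+ n) - 1ℤ)
    sum₃ = trans (twice-sumDiff-step n sum₂ count₁ sum₁) (identity₃ s f₂ f₃)
    sum₄ : + 2 * sumDiff (4 ℕ.+ n) ≡ - s * (fibℤ (6 ℕ.+ n) - + 2)
    sum₄ = trans (twice-sumDiff-step (suc n) sum₃ count₂ sum₂) (identity₄ s f₂ f₃)
    sum₅ : + 2 * sumDiff (5 ℕ.+ n) ≡ - s * (fibℤ (5 ℕ.+ n) - 1ℤ)
    sum₅ = trans (twice-sumDiff-step (2 ℕ.+ n) sum₄ count₃ sum₃) (identity₅ s f₂ f₃)

  closedFormsAt-3r : ∀ r → ClosedFormsAt (3 ℕ.* r) (-1ℤ ^ r)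
  closedFormsAt-3r zero    = closedFormsAt-0
  closedFormsAt-3r (suc r) =
    subst₂ ClosedFormsAt (sym (*-suc 3 r)) (sym (-1*i≡-i (-1ℤ ^ r))) (closedFormsAt-+3 (closedFormsAt-3r r))

  sumDiff-closed : ∀ {n s} q → ClosedFormsAt n s → F (suc n) ≡ suc (q ℕ.* 2) →
                   sumDiff n ≡ s * + ((F (suc n) ℕ.∸ 1) ℕ./ 2)
  sumDiff-closed {n} {s} q cf odd rewrite ∸1/2-odd q odd =
    *-cancelˡ-≡ (+ 2) (sumDiff n) (s * + q) (begin
      + 2 * sumDiff n                  ≡⟨ ClosedFormsAt.sum₀ cf ⟩
      s * (+ F (suc n) - 1ℤ)          ≡⟨ cong (λ m → s * (+ m - 1ℤ)) odd ⟩
      s * ((1ℤ + + (q ℕ.* 2)) - 1ℤ)   ≡⟨ cong (λ t → s * ((1ℤ + t) - 1ℤ)) (pos-* q 2) ⟩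
      s * ((1ℤ + + q * + 2) - 1ℤ)     ≡⟨ lemma s (+ q) ⟩
      + 2 * (s * + q)                  ∎)
    where
    open ≡-Reasoning
    lemma : ∀ s q → s * ((1ℤ + q * + 2) - 1ℤ) ≡ + 2 * (s * q)
    lemma = solve-∀

open import Data.Nat using (ℕ; suc; _*_; _∸_; _/_; _≤_)
open import Data.List using (length)
open import Data.Nat.ListAction using (sum)
open import Data.Integer using (+_; _-_; -1ℤ; _^_) renaming (_*_ to _*ℤ_)
open import Data.Integer.Properties using (i-j≡0⇒i≡j; +-injective)
open import Data.Product using (_×_; _,_)
open import Relation.Binary.PropositionalEquality using (_≡_)
open FibonacciBlocks using (F-odd-at-3r+1)
open SignedDifferences using (ClosedFormsAt; closedFormsAt-3r; sumDiff-closed)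

proposition64 : (r : ℕ) → 1 ≤ r →
    (length (ftmClass 0 (F (3 * r))) ≡ length (ftmClass 1 (F (3 * r))))
      × ((+ sum (ftmClass 0 (F (3 * r)))) - (+ sum (ftmClass 1 (F (3 * r))))
          ≡ (-1ℤ ^ r) *ℤ (+ ((F (suc (3 * r)) ∸ 1) / 2)))
proposition64 r _ with F-odd-at-3r+1 r
... | q , odd = +-injective (i-j≡0⇒i≡j _ _ (ClosedFormsAt.count₀ closedForms))
              , sumDiff-closed q closedForms odd
  where
  closedForms : ClosedFormsAt (3 * r) (-1ℤ ^ r)
  closedForms = closedFormsAt-3r r
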